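{- Let $\mathcal{A}$ be a commutative integral domain of characteristic $0$, let $w_1^+,w_1^-\ge 0$ be integers such that $w_1^+!\,w_1^-!$ is invertible in $\mathcal{A}$, and let $0\le k\le w_1^+$, $0\le l\le w_1^-$. For every $P\in\mathcal{A}[X,Y,Z;A,B,C]_{w_1^+,w_1^- }$ and every $g\in\mathrm{GL}_2(\mathcal{A})$ we have $$\Bigl(\nabla_{k,l}\bigl(\varrho^{(3)}_{w_1^+,w_1^-,0}(\iota(g))P\bigr)\Bigr)(X,Y)=(\det g)^{ -(w_1^--l)}\,(\nabla_{k,l}P)\bigl((X,Y)g\bigr).$$ In particular, $\nabla_{k,l}$ induces a $\mathrm{GL}_2(\mathcal{A})$-equivariant homomorphism $$\nabla_{k,l}\colon L^{(3)}(w_1^+,w_1^-,0;\mathcal{A})|_{\mathrm{GL}_2(\mathcal{A})}\longrightarrow L^{(2)}\bigl(w_1^++w_1^--k-l,\,-(w_1^--l);\mathcal{A}\bigr).$$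
   Context: $\mathcal{A}[X,Y,Z;A,B,C]_{w_1^+,w_1^- }$ denotes the polynomials in $X,Y,Z,A,B,C$ with coefficients in $\mathcal{A}$ that are homogeneous of degree $w_1^+$ in $X,Y,Z$ and of degree $w_1^-$ in $A,B,C$. For integers $w_1^+,w_1^-\ge0$ and $w_2$, $\mathrm{GL}_3(\mathcal{A})$ acts on this space by $\varrho^{(3)}_{w_1^+,w_1^-,w_2}(g)P(X,Y,Z;A,B,C)=(\det g)^{w_2}P((X,Y,Z)g;(A,B,C)\,{}^{t}g^{ -1})$. $L^{(3)}(w_1^+,w_1^-,w_2;\mathcal{A})$ is the kernel of the operator $\frac{\partial^2}{\partial X\partial A}+\frac{\partial^2}{\partial Y\partial B}+\frac{\partial^2}{\partial Z\partial C}$ on this space, a $\mathrm{GL}_3(\mathcal{A})$-subrepresentation. For integers $n_1\ge0$ and $n_2$, $L^{(2)}(n_1,n_2;\mathcal{A})=\mathcal{A}[X,Y]_{n_1}$ is the space of homogeneous polynomials of degree $n_1$ in $X,Y$, with $\mathrm{GL}_2(\mathcal{A})$-action $g\cdot P(X,Y)=(\det g)^{n_2}P((X,Y)g)$. The embedding is $\iota(g)=\begin{pmatrix} g&0\\0&1\end{pmatrix}$. Finally, $$(\nabla_{k,l}P)(X,Y)=\frac{1}{k!\,l!}\frac{\partial^{k+l}P}{\partial Z^k\partial C^l}(X,Y,0;-Y,X,0).$$ -}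

module Defs where

open import Level using (_⊔_)
open import Algebra.Bundles using (CommutativeRing)
open import Data.Nat using (ℕ; zero; suc)
open import Data.Fin using (Fin; zero; suc)
open import Data.Fin.Properties using (_≟_)
open import Data.Sum using (_⊎_)
open import Relation.Nullary using (¬_; yes; no)
open import Relation.Binary.PropositionalEquality using (_≡_)

module Poly {c ℓ} (R : CommutativeRing c ℓ) where
  open CommutativeRing R hiding (zero)

  fromℕ : ℕ → Carrier
  fromℕ zero    = 0#
  fromℕ (suc n) = 1# + fromℕ n

  pow : Carrier → ℕ → Carrier
  pow x zero    = 1#
  pow x (suc n) = x * pow x n

  IsIntegralDomain : Set (c ⊔ ℓ)
  IsIntegralDomain =
    (¬ (1# ≈ 0#)) × (∀ x y → x * y ≈ 0# → x ≈ 0# ⊎ y ≈ 0#)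
    where open import Data.Product using (_×_)

  HasCharZero : Set ℓ
  HasCharZero = ∀ n → ¬ (n ≡ 0) → ¬ (fromℕ n ≈ 0#)

  -- Polynomials with coefficients in 𝒜 in the variables indexed by Fin n,
  -- given as formal expressions.
  infixl 6 _⊕_
  infixl 7 _⊗_
  data Expr (n : ℕ) : Set c where
    con : Carrier → Expr n
    var : Fin n → Expr n
    _⊕_ : Expr n → Expr n → Expr n
    _⊗_ : Expr n → Expr n → Expr n
    ⊝_  : Expr n → Expr n

  ⟦_⟧ : ∀ {n} → Expr n → (Fin n → Carrier) → Carrier
  ⟦ con a ⟧ ρ = a
  ⟦ var i ⟧ ρ = ρ i
  ⟦ e ⊕ f ⟧ ρ = ⟦ e ⟧ ρ + ⟦ f ⟧ ρ
  ⟦ e ⊗ f ⟧ ρ = ⟦ e ⟧ ρ * ⟦ f ⟧ ρ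
  ⟦ ⊝ e ⟧ ρ   = - ⟦ e ⟧ ρ

  -- equality of polynomials (𝒜 is an infinite domain in our setting,
  -- so polynomials are determined by their values)
  infix 4 _≐_
  _≐_ : ∀ {n} → Expr n → Expr n → Set (c ⊔ ℓ)
  e ≐ f = ∀ ρ → ⟦ e ⟧ ρ ≈ ⟦ f ⟧ ρ

  subst : ∀ {n m} → (Fin n → Expr m) → Expr n → Expr m
  subst σ (con a) = con a
  subst σ (var i) = σ i
  subst σ (e ⊕ f) = subst σ e ⊕ subst σ f
  subst σ (e ⊗ f) = subst σ e ⊗ subst σ f
  subst σ (⊝ e)   = ⊝ subst σ e

  ∂ : ∀ {n} → Fin n → Expr n → Expr n
  ∂ i (con a) = con 0#
  ∂ i (var j) with i ≟ j
  ... | yes _ = con 1#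
  ... | no  _ = con 0#
  ∂ i (e ⊕ f) = ∂ i e ⊕ ∂ i f
  ∂ i (e ⊗ f) = ∂ i e ⊗ f ⊕ e ⊗ ∂ i f
  ∂ i (⊝ e)   = ⊝ ∂ i e

  ∂^ : ∀ {n} → Fin n → ℕ → Expr n → Expr n
  ∂^ i zero    e = e
  ∂^ i (suc k) e = ∂ i (∂^ i k e)

  vX vY vZ vA vB vC : Expr 6
  vX = var zero
  vY = var (suc zero)
  vZ = var (suc (suc zero))
  vA = var (suc (suc (suc zero)))
  vB = var (suc (suc (suc (suc zero))))
  vC = var (suc (suc (suc (suc (suc zero)))))

  iZ iC : Fin 6
  iZ = suc (suc zero)
  iC = suc (suc (suc (suc (suc zero))))

  uX uY : Expr 2
  uX = var zero
  uY = var (suc zero)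

  IsBihomogeneous : ℕ → ℕ → Expr 6 → Set (c ⊔ ℓ)
  IsBihomogeneous w⁺ w⁻ P =
    ∀ t s ρ → ⟦ P ⟧ (scale t s ρ) ≈ pow t w⁺ * pow s w⁻ * ⟦ P ⟧ ρ
    where
    scale : Carrier → Carrier → (Fin 6 → Carrier) → Fin 6 → Carrier
    scale t s ρ zero                = t * ρ zero
    scale t s ρ (suc zero)          = t * ρ (suc zero)
    scale t s ρ (suc (suc zero))    = t * ρ (suc (suc zero))
    scale t s ρ (suc (suc (suc i))) = s * ρ (suc (suc (suc i)))

  IsHomogeneous₂ : ℕ → Expr 2 → Set (c ⊔ ℓ)
  IsHomogeneous₂ n Q = ∀ t ρ → ⟦ Q ⟧ (λ i → t * ρ i) ≈ pow t n * ⟦ Q ⟧ ρ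

  -- An element g = (a b ; c d) of GL₂(𝒜), together with the inverse δ of det g.
  record GL₂ : Set (c ⊔ ℓ) where
    field
      a b c' d δ : Carrier
      det-inv : (a * d - b * c') * δ ≈ 1#

  det : GL₂ → Carrier
  det g = a * d - b * c' where open GL₂ g

  -- ϱ⁽³⁾_{w⁺,w⁻,0}(ι(g)) P = P((X,Y,Z)ι(g); (A,B,C) ᵗι(g)⁻¹), where
  -- ι(g) = (a b 0 ; c d 0 ; 0 0 1), ᵗι(g)⁻¹ = δ·(d -c 0 ; -b a 0 ; 0 0 det g).
  -- (the factor (det ι(g))^{w₂} equals 1 as w₂ = 0)
  ϱ3ι : GL₂ → Expr 6 → Expr 6
  ϱ3ι g = subst σ
    where
    open GL₂ g
    σ : Fin 6 → Expr 6
    σ zero                               = con a ⊗ vX ⊕ con c' ⊗ vY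
    σ (suc zero)                         = con b ⊗ vX ⊕ con d ⊗ vY
    σ (suc (suc zero))                   = vZ
    σ (suc (suc (suc zero)))             = con δ ⊗ (con d ⊗ vA ⊕ ⊝ (con b ⊗ vB))
    σ (suc (suc (suc (suc zero))))       = con δ ⊗ (⊝ (con c' ⊗ vA) ⊕ con a ⊗ vB)
    σ (suc (suc (suc (suc (suc zero))))) = vC

  act₂ : GL₂ → Expr 2 → Expr 2
  act₂ g = subst σ
    where
    open GL₂ g
    σ : Fin 2 → Expr 2
    σ zero       = con a ⊗ uX ⊕ con c' ⊗ uY
    σ (suc zero) = con b ⊗ uX ⊕ con d ⊗ uY

  -- ∇_{k,l} P = (1/(k! l!)) ∂^{k+l}P/∂Z^k∂C^l (X,Y,0;-Y,X,0),
  -- where κ stands for the inverse 1/(k! l!) in 𝒜.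
  ∇ : Carrier → ℕ → ℕ → Expr 6 → Expr 2
  ∇ κ k l P = con κ ⊗ subst τ (∂^ iZ k (∂^ iC l P))
    where
    τ : Fin 6 → Expr 2
    τ zero                               = uX
    τ (suc zero)                         = uY
    τ (suc (suc zero))                   = con 0#
    τ (suc (suc (suc zero)))             = ⊝ uY
    τ (suc (suc (suc (suc zero))))       = uX
    τ (suc (suc (suc (suc (suc zero))))) = con 0#

module Submission where

-- ∂_Z and ∂_C commute with ϱ(ι g), which fixes Z and C and does not involve them in the other
-- coordinates, so ∇_{k,l}(ϱ(ι g)P) is ∂_Z^k ∂_C^l P evaluated at the image of (X, Y, 0; -Y, X, 0)
-- under ϱ(ι g). That image is the point (X′, Y′, 0; -Y′, X′, 0) for (X′, Y′) = (X, Y)g with its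
-- A, B, C coordinates multiplied by (det g)⁻¹. Since ∂_Z^k ∂_C^l P is homogeneous of degree w⁻ - l
-- in A, B, C and of degree w⁺ - k in X, Y, Z, this gives the factor (det g)^{-(w⁻-l)} and the
-- homogeneity of ∇_{k,l}P.
--
-- Polynomials are formal expressions compared through their values, so the argument rests on
-- formal derivatives being determined by values. Over an infinite domain they are: ∂ᵢe(ρ) is the
-- linear coefficient of the polynomial h ↦ e(ρ + h eᵢ), and a polynomial vanishing at 1, 2, 3, …
-- is zero.

open import Defs
open import Algebra.Bundles using (CommutativeRing)
open import Data.Nat using (ℕ; _≤_; _∸_) renaming (_+_ to _+ℕ_; _*_ to _*ℕ_)
open import Data.Nat using () renaming (_! to _!ℕ)
open import Data.Product using (_×_; Σ-syntax)

open import Algebra.Bundles using (RawRing)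
import Algebra.Properties.AbelianGroup as AbelianGroupProperties
import Algebra.Properties.CommutativeSemigroup as CommutativeSemigroupProperties
import Algebra.Properties.Ring as RingProperties
import Algebra.Properties.Semiring.Mult as SemiringMult
import Algebra.Solver.Ring
open import Algebra.Solver.Ring.AlmostCommutativeRing
  using (fromCommutativeRing; _-Raw-AlmostCommutative⟶_)
open import Data.Bool using (Bool; true; false; if_then_else_; not; _∨_)
open import Data.Bool.Properties using (∨-conicalˡ; ∨-conicalʳ)
open import Data.Empty using (⊥-elim)
open import Data.Fin using (Fin; zero; suc)
open import Data.Fin.Patterns using (0F; 1F; 2F; 3F; 4F; 5F)
open import Data.Fin.Properties using (_≟_)
open import Data.List using (List; []; _∷_; length)
open import Data.Maybe using (Maybe; just; nothing)
open import Data.Nat using (zero; suc)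
import Data.Nat.Properties as ℕₚ
open import Data.Product using (_,_; proj₁; proj₂)
open import Data.Sum using (inj₁; inj₂)
open import Function using (_∘_)
open import Level using (_⊔_)
open import Relation.Binary.PropositionalEquality as ≡ using (_≡_)
open import Relation.Nullary using (yes; no; does)

module _ {c ℓ} (R : CommutativeRing c ℓ) where
  open CommutativeRing R hiding (zero)
  open Poly R
  open AbelianGroupProperties +-abelianGroup
    using (⁻¹-∙-comm; ⁻¹-anti-homo‿-; ⁻¹-involutive; ε⁻¹≈ε; x∙y⁻¹≈ε⇒x≈y; x≈y⇒x∙y⁻¹≈ε)
  open CommutativeSemigroupProperties +-commutativeSemigroup using (interchange)
  open CommutativeSemigroupProperties *-commutativeSemigroup using (x∙yz≈y∙xz)
  open RingProperties ring using (-‿distribˡ-*; -‿distribʳ-*; -1*x≈-x; x[y-z]≈xy-xz)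
  open SemiringMult semiring using (×-homo-+; ×1-homo-*) renaming (_×_ to _×ℕ_)
  open import Relation.Binary.Reasoning.Setoid setoid

  fromℕ≡×1# : ∀ n → fromℕ n ≡ n ×ℕ 1#
  fromℕ≡×1# zero    = ≡.refl
  fromℕ≡×1# (suc n) = ≡.cong (1# +_) (fromℕ≡×1# n)

  fromℕ-+ : ∀ m n → fromℕ (m +ℕ n) ≈ fromℕ m + fromℕ n
  fromℕ-+ m n rewrite fromℕ≡×1# (m +ℕ n) | fromℕ≡×1# m | fromℕ≡×1# n = ×-homo-+ 1# m n

  fromℕ-* : ∀ m n → fromℕ (m *ℕ n) ≈ fromℕ m * fromℕ n
  fromℕ-* m n rewrite fromℕ≡×1# (m *ℕ n) | fromℕ≡×1# m | fromℕ≡×1# n = ×1-homo-* m n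

  -x*-y≈x*y : ∀ x y → - x * - y ≈ x * y
  -x*-y≈x*y x y = begin
    - x * - y     ≈⟨ -‿distribˡ-* x (- y) ⟨
    - (x * - y)   ≈⟨ -‿cong (-‿distribʳ-* x y) ⟨
    - (- (x * y)) ≈⟨ ⁻¹-involutive (x * y) ⟩
    x * y ∎

  x+w≈z+y⇒x-y≈z-w : ∀ {x y z w} → x + w ≈ z + y → x - y ≈ z - w
  x+w≈z+y⇒x-y≈z-w {x} {y} {z} {w} x+w≈z+y = begin
    x + - y               ≈⟨ +-identityʳ _ ⟨
    (x + - y) + 0#        ≈⟨ +-congˡ (-‿inverseʳ w) ⟨
    (x + - y) + (w + - w) ≈⟨ interchange x (- y) w (- w) ⟩
    (x + w) + (- y + - w) ≈⟨ +-cong x+w≈z+y (+-comm (- y) (- w)) ⟩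
    (z + y) + (- w + - y) ≈⟨ interchange z y (- w) (- y) ⟩
    (z + - w) + (y + - y) ≈⟨ +-congˡ (-‿inverseʳ y) ⟩
    (z + - w) + 0#        ≈⟨ +-identityʳ _ ⟩
    z + - w               ∎

  sum-of-differences : ∀ x y z w → (x + z) - (y + w) ≈ (x - y) + (z - w)
  sum-of-differences x y z w = begin
    (x + z) + - (y + w)   ≈⟨ +-congˡ (⁻¹-∙-comm y w) ⟨
    (x + z) + (- y + - w) ≈⟨ interchange x z (- y) (- w) ⟩
    (x + - y) + (z + - w) ∎

  product-of-differences : ∀ x y z w → (x * z + y * w) - (x * w + y * z) ≈ (x - y) * (z - w)
  product-of-differences x y z w = sym (begin
    (x + - y) * (z + - w)                     ≈⟨ distribʳ _ _ _ ⟩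
    x * (z + - w) + - y * (z + - w)           ≈⟨ +-cong (distribˡ _ _ _) (distribˡ _ _ _) ⟩
    (x * z + x * - w) + (- y * z + - y * - w) ≈⟨ +-cong (+-congˡ (sym (-‿distribʳ-* x w)))
                                                     (+-cong (sym (-‿distribˡ-* y z)) (-x*-y≈x*y y w)) ⟩
    (x * z + - (x * w)) + (- (y * z) + y * w) ≈⟨ +-congˡ (+-comm _ _) ⟩
    (x * z + - (x * w)) + (y * w + - (y * z)) ≈⟨ interchange _ _ _ _ ⟩
    (x * z + y * w) + (- (x * w) + - (y * z)) ≈⟨ +-congˡ (⁻¹-∙-comm _ _) ⟩
    (x * z + y * w) + - (x * w + y * z)       ∎)

  -- The ring solver needs coefficients with decidable equality: formal
  -- differences p - n of naturals, in normal form (one side zero).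
  Difference : Set
  Difference = ℕ × ℕ

  normalise : ℕ → ℕ → Difference
  normalise zero    n       = zero , n
  normalise (suc p) zero    = suc p , zero
  normalise (suc p) (suc n) = normalise p n

  DifferenceRing : RawRing _ _
  DifferenceRing = record
    { Carrier = Difference
    ; _≈_     = _≡_
    ; _+_     = λ { (p , n) (q , m) → normalise (p +ℕ q) (n +ℕ m) }
    ; _*_     = λ { (p , n) (q , m) → normalise (p *ℕ q +ℕ n *ℕ m) (p *ℕ m +ℕ n *ℕ q) }
    ; -_      = λ { (p , n) → n , p }
    ; 0#      = 0 , 0
    ; 1#      = 1 , 0
    }

  -- The first two clauses make the solver's constants 0 and 1 denote 0# and 1# literally.
  ⟦_⟧ᵈ : Difference → Carrier
  ⟦ 0 , 0 ⟧ᵈ = 0#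
  ⟦ 1 , 0 ⟧ᵈ = 1#
  ⟦ p , n ⟧ᵈ = fromℕ p - fromℕ n

  ⟦⟧ᵈ-difference : ∀ p n → ⟦ p , n ⟧ᵈ ≈ fromℕ p - fromℕ n
  ⟦⟧ᵈ-difference 0             0       = sym (-‿inverseʳ 0#)
  ⟦⟧ᵈ-difference 1             0       =
    sym (trans (+-congˡ ε⁻¹≈ε) (trans (+-identityʳ _) (+-identityʳ _)))
  ⟦⟧ᵈ-difference 0             (suc n) = refl
  ⟦⟧ᵈ-difference 1             (suc n) = refl
  ⟦⟧ᵈ-difference (suc (suc p)) n       = refl

  ⟦normalise⟧ : ∀ p n → ⟦ normalise p n ⟧ᵈ ≈ fromℕ p - fromℕ n
  ⟦normalise⟧ zero    n       = ⟦⟧ᵈ-difference zero n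
  ⟦normalise⟧ (suc p) zero    = ⟦⟧ᵈ-difference (suc p) zero
  ⟦normalise⟧ (suc p) (suc n) = trans (⟦normalise⟧ p n) (x+w≈z+y⇒x-y≈z-w p+[1+n]≈[1+p]+n)
    where
    p+[1+n]≈[1+p]+n : fromℕ p + fromℕ (suc n) ≈ fromℕ (suc p) + fromℕ n
    p+[1+n]≈[1+p]+n = trans (sym (fromℕ-+ p (suc n)))
                        (trans (reflexive (≡.cong fromℕ (ℕₚ.+-suc p n))) (fromℕ-+ (suc p) n))

  ⟦⟧ᵈ-homomorphism : DifferenceRing -Raw-AlmostCommutative⟶ fromCommutativeRing R
  ⟦⟧ᵈ-homomorphism = record
    { ⟦_⟧    = ⟦_⟧ᵈ
    ; +-homo = λ { (p , n) (q , m) → begin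
        ⟦ normalise (p +ℕ q) (n +ℕ m) ⟧ᵈ
          ≈⟨ ⟦normalise⟧ (p +ℕ q) (n +ℕ m) ⟩
        fromℕ (p +ℕ q) - fromℕ (n +ℕ m)
          ≈⟨ +-cong (fromℕ-+ p q) (-‿cong (fromℕ-+ n m)) ⟩
        (fromℕ p + fromℕ q) - (fromℕ n + fromℕ m)
          ≈⟨ sum-of-differences _ _ _ _ ⟩
        (fromℕ p - fromℕ n) + (fromℕ q - fromℕ m)
          ≈⟨ +-cong (⟦⟧ᵈ-difference p n) (⟦⟧ᵈ-difference q m) ⟨
        ⟦ p , n ⟧ᵈ + ⟦ q , m ⟧ᵈ ∎ }
    ; *-homo = λ { (p , n) (q , m) → begin
        ⟦ normalise (p *ℕ q +ℕ n *ℕ m) (p *ℕ m +ℕ n *ℕ q) ⟧ᵈ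
          ≈⟨ ⟦normalise⟧ (p *ℕ q +ℕ n *ℕ m) (p *ℕ m +ℕ n *ℕ q) ⟩
        fromℕ (p *ℕ q +ℕ n *ℕ m) - fromℕ (p *ℕ m +ℕ n *ℕ q)
          ≈⟨ +-cong (fromℕ-+*+ p q n m) (-‿cong (fromℕ-+*+ p m n q)) ⟩
        (fromℕ p * fromℕ q + fromℕ n * fromℕ m) - (fromℕ p * fromℕ m + fromℕ n * fromℕ q)
          ≈⟨ product-of-differences _ _ _ _ ⟩
        (fromℕ p - fromℕ n) * (fromℕ q - fromℕ m)
          ≈⟨ *-cong (⟦⟧ᵈ-difference p n) (⟦⟧ᵈ-difference q m) ⟨
        ⟦ p , n ⟧ᵈ * ⟦ q , m ⟧ᵈ ∎ }
    ; -‿homo = λ { (p , n) → begin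
        ⟦ n , p ⟧ᵈ            ≈⟨ ⟦⟧ᵈ-difference n p ⟩
        fromℕ n - fromℕ p     ≈⟨ ⁻¹-anti-homo‿- (fromℕ p) (fromℕ n) ⟨
        - (fromℕ p - fromℕ n) ≈⟨ -‿cong (⟦⟧ᵈ-difference p n) ⟨
        - ⟦ p , n ⟧ᵈ          ∎ }
    ; 0-homo = refl
    ; 1-homo = refl
    }
    where
    fromℕ-+*+ : ∀ a b c d → fromℕ (a *ℕ b +ℕ c *ℕ d) ≈ fromℕ a * fromℕ b + fromℕ c * fromℕ d
    fromℕ-+*+ a b c d = trans (fromℕ-+ (a *ℕ b) (c *ℕ d)) (+-cong (fromℕ-* a b) (fromℕ-* c d))

  ⟦⟧ᵈ-equal? : ∀ x y → Maybe (⟦ x ⟧ᵈ ≈ ⟦ y ⟧ᵈ)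
  ⟦⟧ᵈ-equal? (p , n) (q , m) with p +ℕ m ℕₚ.≟ q +ℕ n
  ... | no _   = nothing
  ... | yes eq = just (begin
    ⟦ p , n ⟧ᵈ        ≈⟨ ⟦⟧ᵈ-difference p n ⟩
    fromℕ p - fromℕ n ≈⟨ x+w≈z+y⇒x-y≈z-w p+m≈q+n ⟩
    fromℕ q - fromℕ m ≈⟨ ⟦⟧ᵈ-difference q m ⟨
    ⟦ q , m ⟧ᵈ        ∎)
    where
    p+m≈q+n : fromℕ p + fromℕ m ≈ fromℕ q + fromℕ n
    p+m≈q+n = trans (sym (fromℕ-+ p m)) (trans (reflexive (≡.cong fromℕ eq)) (fromℕ-+ q n))

  open Algebra.Solver.Ring DifferenceRing (fromCommutativeRing R) ⟦⟧ᵈ-homomorphism ⟦⟧ᵈ-equal?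
    using (Polynomial; solve; _:=_; _:+_; _:*_; :-_; _:-_; con)

  :0 : ∀ {n} → Polynomial n
  :0 = con (0 , 0)

  [x+y]-x≈y : ∀ x y → (x + y) - x ≈ y
  [x+y]-x≈y = solve 2 (λ x y → (x :+ y) :- x := y) refl

  pow-+ : ∀ x m n → pow x (m +ℕ n) ≈ pow x m * pow x n
  pow-+ x zero    n = sym (*-identityˡ _)
  pow-+ x (suc m) n = trans (*-congˡ (pow-+ x m n)) (sym (*-assoc _ _ _))

  pow-1# : ∀ n → pow 1# n ≈ 1#
  pow-1# zero    = refl
  pow-1# (suc n) = trans (*-identityˡ _) (pow-1# n)

  -- Univariate polynomials

  Univariate : Set c
  Univariate = List Carrier

  infix  8 _at_
  infixl 6 _+ᵘ_ _-ᵘ_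
  infixr 7 _·ᵘ_
  infixl 7 _*ᵘ_

  _at_ : Univariate → Carrier → Carrier
  []      at x = 0#
  (a ∷ p) at x = a + x * p at x

  _+ᵘ_ : Univariate → Univariate → Univariate
  []      +ᵘ q       = q
  (a ∷ p) +ᵘ []      = a ∷ p
  (a ∷ p) +ᵘ (b ∷ q) = a + b ∷ p +ᵘ q

  _·ᵘ_ : Carrier → Univariate → Univariate
  a ·ᵘ []      = []
  a ·ᵘ (b ∷ p) = a * b ∷ a ·ᵘ p

  _*ᵘ_ : Univariate → Univariate → Univariate
  []      *ᵘ q = []
  (a ∷ p) *ᵘ q = a ·ᵘ q +ᵘ (0# ∷ p *ᵘ q)

  _-ᵘ_ : Univariate → Univariate → Univariate
  p -ᵘ q = p +ᵘ (- 1#) ·ᵘ q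

  monomial : ℕ → Univariate
  monomial zero    = 1# ∷ []
  monomial (suc n) = 0# ∷ monomial n

  coeff : ℕ → Univariate → Carrier
  coeff n       []      = 0#
  coeff zero    (a ∷ p) = a
  coeff (suc n) (a ∷ p) = coeff n p

  at-+ᵘ : ∀ p q x → (p +ᵘ q) at x ≈ p at x + q at x
  at-+ᵘ []      q       x = sym (+-identityˡ _)
  at-+ᵘ (a ∷ p) []      x = sym (+-identityʳ _)
  at-+ᵘ (a ∷ p) (b ∷ q) x = trans (+-congˡ (*-congˡ (at-+ᵘ p q x))) (lemma a b x _ _)
    where
    lemma : ∀ a b x u v → (a + b) + x * (u + v) ≈ (a + x * u) + (b + x * v)
    lemma = solve 5 (λ a b x u v → (a :+ b) :+ x :* (u :+ v) := (a :+ x :* u) :+ (b :+ x :* v)) refl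

  at-·ᵘ : ∀ a p x → (a ·ᵘ p) at x ≈ a * p at x
  at-·ᵘ a []      x = sym (zeroʳ a)
  at-·ᵘ a (b ∷ p) x = trans (+-congˡ (*-congˡ (at-·ᵘ a p x))) (lemma a b x _)
    where
    lemma : ∀ a b x u → a * b + x * (a * u) ≈ a * (b + x * u)
    lemma = solve 4 (λ a b x u → a :* b :+ x :* (a :* u) := a :* (b :+ x :* u)) refl

  at-*ᵘ : ∀ p q x → (p *ᵘ q) at x ≈ p at x * q at x
  at-*ᵘ []      q x = sym (zeroˡ _)
  at-*ᵘ (a ∷ p) q x = begin
    (a ·ᵘ q +ᵘ (0# ∷ p *ᵘ q)) at x            ≈⟨ at-+ᵘ (a ·ᵘ q) (0# ∷ p *ᵘ q) x ⟩
    (a ·ᵘ q) at x + (0# + x * (p *ᵘ q) at x)  ≈⟨ +-cong (at-·ᵘ a q x) (+-congˡ (*-congˡ (at-*ᵘ p q x))) ⟩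
    a * q at x + (0# + x * (p at x * q at x)) ≈⟨ lemma a x _ _ ⟩
    (a + x * p at x) * q at x                 ∎
    where
    lemma : ∀ a x u v → a * v + (0# + x * (u * v)) ≈ (a + x * u) * v
    lemma = solve 4 (λ a x u v → a :* v :+ (:0 :+ x :* (u :* v)) := (a :+ x :* u) :* v) refl

  at--ᵘ : ∀ p q x → (p -ᵘ q) at x ≈ p at x - q at x
  at--ᵘ p q x = trans (at-+ᵘ p ((- 1#) ·ᵘ q) x) (+-congˡ (trans (at-·ᵘ (- 1#) q x) (-1*x≈-x _)))

  at-monomial : ∀ n x → monomial n at x ≈ pow x n
  at-monomial zero    x = trans (+-congˡ (zeroʳ x)) (+-identityʳ 1#)
  at-monomial (suc n) x = trans (+-identityˡ _) (*-congˡ (at-monomial n x))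

  coeff-+ᵘ : ∀ n p q → coeff n (p +ᵘ q) ≈ coeff n p + coeff n q
  coeff-+ᵘ n       []      q       = sym (+-identityˡ _)
  coeff-+ᵘ n       (a ∷ p) []      = sym (+-identityʳ _)
  coeff-+ᵘ zero    (a ∷ p) (b ∷ q) = refl
  coeff-+ᵘ (suc n) (a ∷ p) (b ∷ q) = coeff-+ᵘ n p q

  coeff-·ᵘ : ∀ n a p → coeff n (a ·ᵘ p) ≈ a * coeff n p
  coeff-·ᵘ n       a []      = sym (zeroʳ a)
  coeff-·ᵘ zero    a (b ∷ p) = refl
  coeff-·ᵘ (suc n) a (b ∷ p) = coeff-·ᵘ n a p

  coeff--ᵘ : ∀ n p q → coeff n (p -ᵘ q) ≈ coeff n p - coeff n q
  coeff--ᵘ n p q =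
    trans (coeff-+ᵘ n p ((- 1#) ·ᵘ q)) (+-congˡ (trans (coeff-·ᵘ n (- 1#) q) (-1*x≈-x _)))

  coeff₀-*ᵘ : ∀ p q → coeff 0 (p *ᵘ q) ≈ coeff 0 p * coeff 0 q
  coeff₀-*ᵘ []      q = sym (zeroˡ _)
  coeff₀-*ᵘ (a ∷ p) q =
    trans (coeff-+ᵘ 0 (a ·ᵘ q) (0# ∷ p *ᵘ q)) (trans (+-identityʳ _) (coeff-·ᵘ 0 a q))

  coeff₁-*ᵘ : ∀ p q → coeff 1 (p *ᵘ q) ≈ coeff 0 p * coeff 1 q + coeff 1 p * coeff 0 q
  coeff₁-*ᵘ []      q = sym (trans (+-cong (zeroˡ _) (zeroˡ _)) (+-identityʳ 0#))
  coeff₁-*ᵘ (a ∷ p) q =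
    trans (coeff-+ᵘ 1 (a ·ᵘ q) (0# ∷ p *ᵘ q)) (+-cong (coeff-·ᵘ 1 a q) (coeff₀-*ᵘ p q))

  quotient : Carrier → Univariate → Univariate
  quotient a []      = []
  quotient a (d ∷ p) = (d ∷ p) at a ∷ quotient a p

  length-quotient : ∀ a p → length (quotient a p) ≡ length p
  length-quotient a []      = ≡.refl
  length-quotient a (d ∷ p) = ≡.cong suc (length-quotient a p)

  x*-at-quotient : ∀ a p x → x * p at x ≈ a * p at a + (x - a) * quotient a p at x
  x*-at-quotient a []      x = lemma x a
    where
    lemma : ∀ x a → x * 0# ≈ a * 0# + (x - a) * 0#
    lemma = solve 2 (λ x a → x :* :0 := a :* :0 :+ (x :- a) :* :0) refl
  x*-at-quotient a (d ∷ p) x = trans (*-congˡ (+-congˡ (x*-at-quotient a p x))) (lemma x a d _ _)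
    where
    lemma : ∀ x a d u v →
            x * (d + (a * u + (x - a) * v)) ≈ a * (d + a * u) + (x - a) * ((d + a * u) + x * v)
    lemma = solve 5 (λ x a d u v → x :* (d :+ (a :* u :+ (x :- a) :* v))
                                 := a :* (d :+ a :* u) :+ (x :- a) :* ((d :+ a :* u) :+ x :* v)) refl

  factor-theorem : ∀ d p a x → (d ∷ p) at x ≈ (d ∷ p) at a + (x - a) * quotient a p at x
  factor-theorem d p a x = trans (+-congˡ (x*-at-quotient a p x)) (lemma d x a _ _)
    where
    lemma : ∀ d x a u v → d + (a * u + (x - a) * v) ≈ (d + a * u) + (x - a) * v
    lemma = solve 5 (λ d x a u v → d :+ (a :* u :+ (x :- a) :* v)
                                 := (d :+ a :* u) :+ (x :- a) :* v) refl

  -- Evaluation, Taylor coefficients and derivatives of substitutions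

  ⟦⟧-cong : ∀ {n} (e : Expr n) {ρ ρ′ : Fin n → Carrier} → (∀ i → ρ i ≈ ρ′ i) → ⟦ e ⟧ ρ ≈ ⟦ e ⟧ ρ′
  ⟦⟧-cong (con a) ρ≈ρ′ = refl
  ⟦⟧-cong (var i) ρ≈ρ′ = ρ≈ρ′ i
  ⟦⟧-cong (e ⊕ f) ρ≈ρ′ = +-cong (⟦⟧-cong e ρ≈ρ′) (⟦⟧-cong f ρ≈ρ′)
  ⟦⟧-cong (e ⊗ f) ρ≈ρ′ = *-cong (⟦⟧-cong e ρ≈ρ′) (⟦⟧-cong f ρ≈ρ′)
  ⟦⟧-cong (⊝ e)   ρ≈ρ′ = -‿cong (⟦⟧-cong e ρ≈ρ′)

  ⟦subst⟧ : ∀ {n m} (σ : Fin n → Expr m) e ρ → ⟦ subst σ e ⟧ ρ ≈ ⟦ e ⟧ (λ j → ⟦ σ j ⟧ ρ)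
  ⟦subst⟧ σ (con a) ρ = refl
  ⟦subst⟧ σ (var i) ρ = refl
  ⟦subst⟧ σ (e ⊕ f) ρ = +-cong (⟦subst⟧ σ e ρ) (⟦subst⟧ σ f ρ)
  ⟦subst⟧ σ (e ⊗ f) ρ = *-cong (⟦subst⟧ σ e ρ) (⟦subst⟧ σ f ρ)
  ⟦subst⟧ σ (⊝ e)   ρ = -‿cong (⟦subst⟧ σ e ρ)

  ⟦_⟧ᵘ : ∀ {n} → Expr n → (Fin n → Univariate) → Univariate
  ⟦ con a ⟧ᵘ π = a ∷ []
  ⟦ var i ⟧ᵘ π = π i
  ⟦ e ⊕ f ⟧ᵘ π = ⟦ e ⟧ᵘ π +ᵘ ⟦ f ⟧ᵘ π
  ⟦ e ⊗ f ⟧ᵘ π = ⟦ e ⟧ᵘ π *ᵘ ⟦ f ⟧ᵘ π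
  ⟦ ⊝ e ⟧ᵘ   π = (- 1#) ·ᵘ ⟦ e ⟧ᵘ π

  at-⟦⟧ᵘ : ∀ {n} e (π : Fin n → Univariate) x → ⟦ e ⟧ᵘ π at x ≈ ⟦ e ⟧ (λ i → π i at x)
  at-⟦⟧ᵘ (con a) π x = trans (+-congˡ (zeroʳ x)) (+-identityʳ a)
  at-⟦⟧ᵘ (var i) π x = refl
  at-⟦⟧ᵘ (e ⊕ f) π x = trans (at-+ᵘ (⟦ e ⟧ᵘ π) (⟦ f ⟧ᵘ π) x) (+-cong (at-⟦⟧ᵘ e π x) (at-⟦⟧ᵘ f π x))
  at-⟦⟧ᵘ (e ⊗ f) π x = trans (at-*ᵘ (⟦ e ⟧ᵘ π) (⟦ f ⟧ᵘ π) x) (*-cong (at-⟦⟧ᵘ e π x) (at-⟦⟧ᵘ f π x))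
  at-⟦⟧ᵘ (⊝ e)   π x = trans (at-·ᵘ (- 1#) (⟦ e ⟧ᵘ π) x) (trans (-1*x≈-x _) (-‿cong (at-⟦⟧ᵘ e π x)))

  -- The entries of ρ + h eᵢ, as polynomials in h.
  shifted : ∀ {n} → Fin n → (Fin n → Carrier) → Fin n → Univariate
  shifted i ρ j with i ≟ j
  ... | yes _ = ρ j ∷ 1# ∷ []
  ... | no  _ = ρ j ∷ []

  taylor : ∀ {n} → Fin n → (Fin n → Carrier) → Expr n → Univariate
  taylor i ρ e = ⟦ e ⟧ᵘ (shifted i ρ)

  coeff₀-taylor : ∀ {n} (i : Fin n) e ρ → coeff 0 (taylor i ρ e) ≈ ⟦ e ⟧ ρ
  coeff₀-taylor i (con a) ρ = refl
  coeff₀-taylor i (var j) ρ with i ≟ j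
  ... | yes _ = refl
  ... | no  _ = refl
  coeff₀-taylor i (e ⊕ f) ρ = trans (coeff-+ᵘ 0 (taylor i ρ e) (taylor i ρ f))
                                    (+-cong (coeff₀-taylor i e ρ) (coeff₀-taylor i f ρ))
  coeff₀-taylor i (e ⊗ f) ρ = trans (coeff₀-*ᵘ (taylor i ρ e) (taylor i ρ f))
                                    (*-cong (coeff₀-taylor i e ρ) (coeff₀-taylor i f ρ))
  coeff₀-taylor i (⊝ e)   ρ = trans (coeff-·ᵘ 0 (- 1#) (taylor i ρ e))
                                    (trans (-1*x≈-x _) (-‿cong (coeff₀-taylor i e ρ)))

  coeff₁-taylor : ∀ {n} (i : Fin n) e ρ → coeff 1 (taylor i ρ e) ≈ ⟦ ∂ i e ⟧ ρ
  coeff₁-taylor i (con a) ρ = refl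
  coeff₁-taylor i (var j) ρ with i ≟ j
  ... | yes _ = refl
  ... | no  _ = refl
  coeff₁-taylor i (e ⊕ f) ρ = trans (coeff-+ᵘ 1 (taylor i ρ e) (taylor i ρ f))
                                    (+-cong (coeff₁-taylor i e ρ) (coeff₁-taylor i f ρ))
  coeff₁-taylor i (e ⊗ f) ρ = begin
    coeff 1 (taylor i ρ e *ᵘ taylor i ρ f)
      ≈⟨ coeff₁-*ᵘ (taylor i ρ e) (taylor i ρ f) ⟩
    coeff 0 (taylor i ρ e) * coeff 1 (taylor i ρ f)
      + coeff 1 (taylor i ρ e) * coeff 0 (taylor i ρ f)
      ≈⟨ +-cong (*-cong (coeff₀-taylor i e ρ) (coeff₁-taylor i f ρ))
                (*-cong (coeff₁-taylor i e ρ) (coeff₀-taylor i f ρ)) ⟩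
    ⟦ e ⟧ ρ * ⟦ ∂ i f ⟧ ρ + ⟦ ∂ i e ⟧ ρ * ⟦ f ⟧ ρ
      ≈⟨ +-comm _ _ ⟩
    ⟦ ∂ i e ⟧ ρ * ⟦ f ⟧ ρ + ⟦ e ⟧ ρ * ⟦ ∂ i f ⟧ ρ
      ∎
  coeff₁-taylor i (⊝ e)   ρ = trans (coeff-·ᵘ 1 (- 1#) (taylor i ρ e))
                                    (trans (-1*x≈-x _) (-‿cong (coeff₁-taylor i e ρ)))

  ∂-con-⊗ : ∀ {n} (i : Fin n) a e → ∂ i (con a ⊗ e) ≐ con a ⊗ ∂ i e
  ∂-con-⊗ i a e ρ = trans (+-congʳ (zeroˡ _)) (+-identityˡ _)

  mentions : ∀ {n} → Fin n → Expr n → Bool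
  mentions i (con a) = false
  mentions i (var j) = does (i ≟ j)
  mentions i (e ⊕ f) = mentions i e ∨ mentions i f
  mentions i (e ⊗ f) = mentions i e ∨ mentions i f
  mentions i (⊝ e)   = mentions i e

  ∂-unused : ∀ {n} (i : Fin n) e → mentions i e ≡ false → ∂ i e ≐ con 0#
  ∂-unused i (con a) _ ρ = refl
  ∂-unused i (var j) unused ρ with i ≟ j
  ∂-unused i (var j) ()     ρ | yes _
  ∂-unused i (var j) unused ρ | no  _ = refl
  ∂-unused i (e ⊕ f) unused ρ =
    trans (+-cong (∂-unused i e e-unused ρ) (∂-unused i f f-unused ρ)) (+-identityʳ 0#)
    where
    e-unused = ∨-conicalˡ _ _ unused
    f-unused = ∨-conicalʳ _ _ unused
  ∂-unused i (e ⊗ f) unused ρ = begin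
    ⟦ ∂ i e ⟧ ρ * ⟦ f ⟧ ρ + ⟦ e ⟧ ρ * ⟦ ∂ i f ⟧ ρ
      ≈⟨ +-cong (*-congʳ (∂-unused i e e-unused ρ)) (*-congˡ (∂-unused i f f-unused ρ)) ⟩
    0# * ⟦ f ⟧ ρ + ⟦ e ⟧ ρ * 0#
      ≈⟨ +-cong (zeroˡ _) (zeroʳ _) ⟩
    0# + 0#
      ≈⟨ +-identityʳ 0# ⟩
    0# ∎
    where
    e-unused = ∨-conicalˡ _ _ unused
    f-unused = ∨-conicalʳ _ _ unused
  ∂-unused i (⊝ e) unused ρ = trans (-‿cong (∂-unused i e unused ρ)) ε⁻¹≈ε

  ∂-Compatible : ∀ {n} → Fin n → Carrier → (Fin n → Expr n) → Set (c ⊔ ℓ)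
  ∂-Compatible i a σ = ∀ j → ∂ i (σ j) ≐ con a ⊗ subst σ (∂ i (var j))

  ∂-subst : ∀ {n} {i : Fin n} {a σ} → ∂-Compatible i a σ →
            ∀ e → ∂ i (subst σ e) ≐ con a ⊗ subst σ (∂ i e)
  ∂-subst {a = a} compatible (con b) ρ = sym (zeroʳ a)
  ∂-subst compatible (var j) ρ = compatible j ρ
  ∂-subst {a = a} compatible (e ⊕ f) ρ =
    trans (+-cong (∂-subst compatible e ρ) (∂-subst compatible f ρ)) (sym (distribˡ a _ _))
  ∂-subst {a = a} compatible (e ⊗ f) ρ =
    trans (+-cong (*-congʳ (∂-subst compatible e ρ)) (*-congˡ (∂-subst compatible f ρ)))
          (lemma a _ _ _ _)
    where
    lemma : ∀ a u v w z → (a * u) * v + w * (a * z) ≈ a * (u * v + w * z)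
    lemma = solve 5 (λ a u v w z → (a :* u) :* v :+ w :* (a :* z) := a :* (u :* v :+ w :* z)) refl
  ∂-subst {a = a} compatible (⊝ e) ρ = trans (-‿cong (∂-subst compatible e ρ)) (-‿distribʳ-* a _)

  factor : ∀ {n} → (Fin n → Bool) → Carrier → Fin n → Carrier
  factor G t j = if G j then t else 1#

  factor-true : ∀ {n} {G : Fin n → Bool} {i} t → G i ≡ true → factor G t i ≡ t
  factor-true t Gi≡true = ≡.cong (λ b → if b then t else 1#) Gi≡true

  factor-false : ∀ {n} {G : Fin n → Bool} {i} t → G i ≡ false → factor G t i ≡ 1#
  factor-false t Gi≡false = ≡.cong (λ b → if b then t else 1#) Gi≡false

  scale : ∀ {n} → (Fin n → Bool) → Carrier → (Fin n → Carrier) → Fin n → Carrier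
  scale G t ρ j = factor G t j * ρ j

  scaling : ∀ {n} → (Fin n → Bool) → Carrier → Fin n → Expr n
  scaling G t j = con (factor G t j) ⊗ var j

  Homogeneous : ∀ {n} → (Fin n → Bool) → ℕ → Expr n → Set (c ⊔ ℓ)
  Homogeneous G m e = ∀ t ρ → ⟦ e ⟧ (scale G t ρ) ≈ pow t m * ⟦ e ⟧ ρ

  scaling-∂-compatible : ∀ {n} G t (i : Fin n) → ∂-Compatible i (factor G t i) (scaling G t)
  scaling-∂-compatible G t i j ρ with i ≟ j
  ... | yes ≡.refl = trans (+-congʳ (zeroˡ _)) (+-identityˡ _)
  ... | no  _      =
    trans (+-congʳ (zeroˡ _)) (trans (+-identityˡ _) (trans (zeroʳ _) (sym (zeroʳ _))))

  scaleᵘ : ∀ {n} → (Fin n → Bool) → (Fin n → Carrier) → Fin n → Univariate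
  scaleᵘ G ρ j = if G j then 0# ∷ ρ j ∷ [] else ρ j ∷ []

  at-scaleᵘ : ∀ {n} G (ρ : Fin n → Carrier) t j → scaleᵘ G ρ j at t ≈ scale G t ρ j
  at-scaleᵘ G ρ t j with G j
  ... | true  = trans (+-identityˡ _) (*-congˡ (trans (+-congˡ (zeroʳ t)) (+-identityʳ _)))
  ... | false = trans (+-congˡ (zeroʳ t)) (trans (+-identityʳ _) (sym (*-identityˡ _)))

  homogeneous-+ : ∀ {n} {G : Fin n → Bool} {a b e} →
                  Homogeneous G a e → Homogeneous (not ∘ G) b e → Homogeneous (λ _ → true) (a +ℕ b) e
  homogeneous-+ {G = G} {a} {b} {e} homogeneous-on homogeneous-off t ρ = begin
    ⟦ e ⟧ (scale (λ _ → true) t ρ)          ≈⟨ ⟦⟧-cong e scale-in-two-steps ⟩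
    ⟦ e ⟧ (scale G t (scale (not ∘ G) t ρ)) ≈⟨ homogeneous-on t _ ⟩
    pow t a * ⟦ e ⟧ (scale (not ∘ G) t ρ)   ≈⟨ *-congˡ (homogeneous-off t ρ) ⟩
    pow t a * (pow t b * ⟦ e ⟧ ρ)           ≈⟨ *-assoc _ _ _ ⟨
    pow t a * pow t b * ⟦ e ⟧ ρ             ≈⟨ *-congʳ (pow-+ t a b) ⟨
    pow t (a +ℕ b) * ⟦ e ⟧ ρ                ∎
    where
    scale-in-two-steps : ∀ j → t * ρ j ≈ scale G t (scale (not ∘ G) t ρ) j
    scale-in-two-steps j with G j
    ... | true  = *-congˡ (sym (*-identityˡ _))
    ... | false = sym (*-identityˡ _)

  -- Consequences of 𝒜 being an infinite domain

  module _ (isDomain : IsIntegralDomain) (charZero : HasCharZero) where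

    cancel-fromℕ-suc : ∀ j y → fromℕ (suc j) * y ≈ 0# → y ≈ 0#
    cancel-fromℕ-suc j y [1+j]y≈0 with proj₂ isDomain _ _ [1+j]y≈0
    ... | inj₁ [1+j]≈0 = ⊥-elim (charZero (suc j) (λ ()) [1+j]≈0)
    ... | inj₂ y≈0     = y≈0

    -- off is a root, and the quotient by x - off vanishes at off + 1, off + 2, …
    -- because the factors fromℕ (suc j) are nonzero.
    vanishing-from : ∀ n p → length p ≡ n → ∀ off →
                     (∀ j → p at fromℕ (off +ℕ j) ≈ 0#) → ∀ x → p at x ≈ 0#
    vanishing-from n       []      _          off _        x = refl
    vanishing-from zero    (d ∷ p) ()
    vanishing-from (suc n) (d ∷ p) ∣d∷p∣≡1+n off vanishes x = begin
      (d ∷ p) at x                    ≈⟨ factor-theorem d p a x ⟩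
      (d ∷ p) at a + (x - a) * q at x ≈⟨ +-cong root (*-congˡ (quotient-vanishes x)) ⟩
      0# + (x - a) * 0#               ≈⟨ trans (+-identityˡ _) (zeroʳ _) ⟩
      0#                              ∎
      where
      a = fromℕ off
      q = quotient a p
      root : (d ∷ p) at a ≈ 0#
      root = trans (reflexive (≡.cong (λ m → (d ∷ p) at fromℕ m) (≡.sym (ℕₚ.+-identityʳ off))))
                   (vanishes 0)
      ∣q∣≡n : length q ≡ n
      ∣q∣≡n = ≡.trans (length-quotient a p) (ℕₚ.suc-injective ∣d∷p∣≡1+n)
      quotient-vanishes : ∀ x → q at x ≈ 0#
      quotient-vanishes = vanishing-from n q ∣q∣≡n (suc off) λ j →
        let b           = fromℕ (suc off +ℕ j)
            b≡off+[1+j] = ≡.cong fromℕ (≡.sym (ℕₚ.+-suc off j))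
        in cancel-fromℕ-suc j _ (begin
          fromℕ (suc j) * q at b              ≈⟨ *-congʳ ([x+y]-x≈y a _) ⟨
          ((a + fromℕ (suc j)) - a) * q at b  ≈⟨ *-congʳ (+-congʳ (fromℕ-+ off (suc j))) ⟨
          (fromℕ (off +ℕ suc j) - a) * q at b ≈⟨ *-congʳ (+-congʳ (reflexive b≡off+[1+j])) ⟨
          (b - a) * q at b                    ≈⟨ +-identityˡ _ ⟨
          0# + (b - a) * q at b               ≈⟨ +-congʳ root ⟨
          (d ∷ p) at a + (b - a) * q at b     ≈⟨ factor-theorem d p a b ⟨
          (d ∷ p) at b                        ≈⟨ reflexive (≡.cong ((d ∷ p) at_) b≡off+[1+j]) ⟩
          (d ∷ p) at fromℕ (off +ℕ suc j)     ≈⟨ vanishes (suc j) ⟩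
          0#                                  ∎)

    x*-vanishing : ∀ p → (∀ x → x * p at x ≈ 0#) → ∀ x → p at x ≈ 0#
    x*-vanishing p xp≈0 = vanishing-from _ p ≡.refl 1 λ j → cancel-fromℕ-suc j _ (xp≈0 _)

    constant-vanishes : ∀ a p → (∀ x → (a ∷ p) at x ≈ 0#) → a ≈ 0#
    constant-vanishes a p vanishes =
      trans (sym (trans (+-congˡ (zeroˡ _)) (+-identityʳ a))) (vanishes 0#)

    coeff-vanishing : ∀ p → (∀ x → p at x ≈ 0#) → ∀ n → coeff n p ≈ 0#
    coeff-vanishing []      _        n       = refl
    coeff-vanishing (a ∷ p) vanishes zero    = constant-vanishes a p vanishes
    coeff-vanishing (a ∷ p) vanishes (suc n) = coeff-vanishing p tail-vanishes n
      where
      tail-vanishes : ∀ x → p at x ≈ 0#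
      tail-vanishes = x*-vanishing p λ x → begin
        x * p at x       ≈⟨ [x+y]-x≈y a (x * p at x) ⟨
        (a ∷ p) at x - a ≈⟨ +-cong (vanishes x) (-‿cong (constant-vanishes a p vanishes)) ⟩
        0# - 0#          ≈⟨ -‿inverseʳ 0# ⟩
        0#               ∎

    coeff-unique : ∀ p q → (∀ x → p at x ≈ q at x) → ∀ n → coeff n p ≈ coeff n q
    coeff-unique p q p≈q n =
      x∙y⁻¹≈ε⇒x≈y _ _ (trans (sym (coeff--ᵘ n p q)) (coeff-vanishing (p -ᵘ q) difference-vanishes n))
      where
      difference-vanishes : ∀ x → (p -ᵘ q) at x ≈ 0#
      difference-vanishes x = trans (at--ᵘ p q x) (x≈y⇒x∙y⁻¹≈ε (p≈q x))

    x*-cancel : ∀ p q → (∀ x → x * p at x ≈ x * q at x) → ∀ x → p at x ≈ q at x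
    x*-cancel p q xp≈xq x =
      x∙y⁻¹≈ε⇒x≈y _ _ (trans (sym (at--ᵘ p q x)) (x*-vanishing (p -ᵘ q) x[p-q]≈0 x))
      where
      x[p-q]≈0 : ∀ x → x * (p -ᵘ q) at x ≈ 0#
      x[p-q]≈0 x = trans (*-congˡ (at--ᵘ p q x)) (trans (x[y-z]≈xy-xz x _ _) (x≈y⇒x∙y⁻¹≈ε (xp≈xq x)))

    ∂-cong : ∀ {n} (i : Fin n) {e f} → e ≐ f → ∂ i e ≐ ∂ i f
    ∂-cong i {e} {f} e≐f ρ = begin
      ⟦ ∂ i e ⟧ ρ            ≈⟨ coeff₁-taylor i e ρ ⟨
      coeff 1 (taylor i ρ e) ≈⟨ coeff-unique (taylor i ρ e) (taylor i ρ f) same-values 1 ⟩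
      coeff 1 (taylor i ρ f) ≈⟨ coeff₁-taylor i f ρ ⟩
      ⟦ ∂ i f ⟧ ρ            ∎
      where
      same-values : ∀ x → taylor i ρ e at x ≈ taylor i ρ f at x
      same-values x = trans (at-⟦⟧ᵘ e (shifted i ρ) x) (trans (e≐f _) (sym (at-⟦⟧ᵘ f (shifted i ρ) x)))

    ∂^-cong : ∀ {n} (i : Fin n) k {e f} → e ≐ f → ∂^ i k e ≐ ∂^ i k f
    ∂^-cong i zero    e≐f = e≐f
    ∂^-cong i (suc k) {e} {f} e≐f = ∂-cong i {∂^ i k e} {∂^ i k f} (∂^-cong i k e≐f)

    ∂^-subst : ∀ {n} {i : Fin n} {σ} → ∂-Compatible i 1# σ →
               ∀ k e → ∂^ i k (subst σ e) ≐ subst σ (∂^ i k e)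
    ∂^-subst compatible zero    e ρ = refl
    ∂^-subst {i = i} {σ} compatible (suc k) e ρ = begin
      ⟦ ∂ i (∂^ i k (subst σ e)) ⟧ ρ      ≈⟨ ∂-cong i {∂^ i k (subst σ e)} {subst σ (∂^ i k e)}
                                                    (∂^-subst compatible k e) ρ ⟩
      ⟦ ∂ i (subst σ (∂^ i k e)) ⟧ ρ      ≈⟨ ∂-subst compatible (∂^ i k e) ρ ⟩
      1# * ⟦ subst σ (∂^ i (suc k) e) ⟧ ρ ≈⟨ *-identityˡ _ ⟩
      ⟦ subst σ (∂^ i (suc k) e) ⟧ ρ      ∎

    factor-∂-homogeneous : ∀ {n} {G : Fin n → Bool} {m} i e → Homogeneous G m e →
                           ∀ t ρ → factor G t i * ⟦ ∂ i e ⟧ (scale G t ρ) ≈ pow t m * ⟦ ∂ i e ⟧ ρ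
    factor-∂-homogeneous {G = G} {m} i e homogeneous t ρ = begin
      factor G t i * ⟦ ∂ i e ⟧ (scale G t ρ)
        ≈⟨ *-congˡ (⟦subst⟧ (scaling G t) (∂ i e) ρ) ⟨
      ⟦ con (factor G t i) ⊗ subst (scaling G t) (∂ i e) ⟧ ρ
        ≈⟨ ∂-subst (scaling-∂-compatible G t i) e ρ ⟨
      ⟦ ∂ i (subst (scaling G t) e) ⟧ ρ
        ≈⟨ ∂-cong i {subst (scaling G t) e} {con (pow t m) ⊗ e} scaled ρ ⟩
      ⟦ ∂ i (con (pow t m) ⊗ e) ⟧ ρ
        ≈⟨ ∂-con-⊗ i (pow t m) e ρ ⟩
      pow t m * ⟦ ∂ i e ⟧ ρ
        ∎
      where
      scaled : subst (scaling G t) e ≐ con (pow t m) ⊗ e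
      scaled ρ = trans (⟦subst⟧ (scaling G t) e ρ) (homogeneous t ρ)

    ∂-preserves-degree : ∀ {n} {G : Fin n → Bool} {m} i e → G i ≡ false →
                         Homogeneous G m e → Homogeneous G m (∂ i e)
    ∂-preserves-degree {G = G} {m} i e Gi≡false homogeneous t ρ = begin
      ⟦ ∂ i e ⟧ (scale G t ρ)                ≈⟨ *-identityˡ _ ⟨
      1# * ⟦ ∂ i e ⟧ (scale G t ρ)           ≈⟨ *-congʳ (reflexive (factor-false {G = G} t Gi≡false)) ⟨
      factor G t i * ⟦ ∂ i e ⟧ (scale G t ρ) ≈⟨ factor-∂-homogeneous {m = m} i e homogeneous t ρ ⟩
      pow t m * ⟦ ∂ i e ⟧ ρ                  ∎

    -- Homogeneity only gives t · ∂ᵢe(t·ρ) = t · tᵐ ∂ᵢe(ρ); t is cancelled by viewing both sides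
    -- as polynomials in t.
    ∂-lowers-degree : ∀ {n} {G : Fin n → Bool} {m} i e → G i ≡ true →
                      Homogeneous G (suc m) e → Homogeneous G m (∂ i e)
    ∂-lowers-degree {G = G} {m} i e Gi≡true homogeneous t ρ = begin
      ⟦ ∂ i e ⟧ (scale G t ρ) ≈⟨ p-at t ⟨
      p at t                  ≈⟨ x*-cancel p q multiplied t ⟩
      q at t                  ≈⟨ q-at t ⟩
      pow t m * ⟦ ∂ i e ⟧ ρ   ∎
      where
      p q : Univariate
      p = ⟦ ∂ i e ⟧ᵘ (scaleᵘ G ρ)
      q = ⟦ ∂ i e ⟧ ρ ·ᵘ monomial m
      p-at : ∀ u → p at u ≈ ⟦ ∂ i e ⟧ (scale G u ρ)
      p-at u = trans (at-⟦⟧ᵘ (∂ i e) (scaleᵘ G ρ) u) (⟦⟧-cong (∂ i e) (at-scaleᵘ G ρ u))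
      q-at : ∀ u → q at u ≈ pow u m * ⟦ ∂ i e ⟧ ρ
      q-at u = trans (at-·ᵘ _ (monomial m) u) (trans (*-congˡ (at-monomial m u)) (*-comm _ _))
      multiplied : ∀ u → u * p at u ≈ u * q at u
      multiplied u = begin
        u * p at u                             ≈⟨ *-congˡ (p-at u) ⟩
        u * ⟦ ∂ i e ⟧ (scale G u ρ)            ≈⟨ *-congʳ (reflexive (factor-true {G = G} u Gi≡true)) ⟨
        factor G u i * ⟦ ∂ i e ⟧ (scale G u ρ) ≈⟨ factor-∂-homogeneous {m = suc m} i e homogeneous u ρ ⟩
        u * pow u m * ⟦ ∂ i e ⟧ ρ              ≈⟨ *-assoc _ _ _ ⟩
        u * (pow u m * ⟦ ∂ i e ⟧ ρ)            ≈⟨ *-congˡ (q-at u) ⟨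
        u * q at u                             ∎

    ∂^-preserves-degree : ∀ {n} {G : Fin n → Bool} {i : Fin n} {m} → G i ≡ false →
                          ∀ l e → Homogeneous G m e → Homogeneous G m (∂^ i l e)
    ∂^-preserves-degree Gi≡false zero    e homogeneous = homogeneous
    ∂^-preserves-degree {i = i} {m} Gi≡false (suc l) e homogeneous =
      ∂-preserves-degree {m = m} i (∂^ i l e) Gi≡false
        (∂^-preserves-degree {m = m} Gi≡false l e homogeneous)

    ∂^-lowers-degree : ∀ {n} {G : Fin n → Bool} {i : Fin n} → G i ≡ true →
                       ∀ l {m} e → Homogeneous G (l +ℕ m) e → Homogeneous G m (∂^ i l e)
    ∂^-lowers-degree Gi≡true zero    e homogeneous = homogeneous
    ∂^-lowers-degree {G = G} {i} Gi≡true (suc l) {m} e homogeneous =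
      ∂-lowers-degree {m = m} i (∂^ i l e) Gi≡true (∂^-lowers-degree Gi≡true l e homogeneous′)
      where
      homogeneous′ : Homogeneous G (l +ℕ suc m) e
      homogeneous′ = ≡.subst (λ d → Homogeneous G d e) (≡.sym (ℕₚ.+-suc l m)) homogeneous

    -- The operator ∇_{k,l}

    isXYZ : Fin 6 → Bool
    isXYZ 0F = true
    isXYZ 1F = true
    isXYZ 2F = true
    isXYZ _  = false

    bihomogeneous-XYZ : ∀ {w⁺ w⁻} P → IsBihomogeneous w⁺ w⁻ P → Homogeneous isXYZ w⁺ P
    bihomogeneous-XYZ {w⁺} {w⁻} P bihomogeneous t ρ =
      trans (⟦⟧-cong P λ { 0F → refl ; 1F → refl ; 2F → refl ; (suc (suc (suc _))) → refl })
            (trans (bihomogeneous t 1# ρ) (*-congʳ (trans (*-congˡ (pow-1# w⁻)) (*-identityʳ _))))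

    bihomogeneous-ABC : ∀ {w⁺ w⁻} P → IsBihomogeneous w⁺ w⁻ P → Homogeneous (not ∘ isXYZ) w⁻ P
    bihomogeneous-ABC {w⁺} {w⁻} P bihomogeneous t ρ =
      trans (⟦⟧-cong P λ { 0F → refl ; 1F → refl ; 2F → refl ; (suc (suc (suc _))) → refl })
            (trans (bihomogeneous 1# t ρ) (*-congʳ (trans (*-congʳ (pow-1# w⁺)) (*-identityˡ _))))

    ∂ZC-bihomogeneous : ∀ {w⁺ w⁻ k l} P → IsBihomogeneous w⁺ w⁻ P → k ≤ w⁺ → l ≤ w⁻ →
                        Homogeneous isXYZ (w⁺ ∸ k) (∂^ iZ k (∂^ iC l P))
                        × Homogeneous (not ∘ isXYZ) (w⁻ ∸ l) (∂^ iZ k (∂^ iC l P))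
    ∂ZC-bihomogeneous {w⁺} {w⁻} {k} {l} P bihomogeneous k≤w⁺ l≤w⁻ =
      ∂^-lowers-degree ≡.refl k (∂^ iC l P)
        (≡.subst (λ d → Homogeneous isXYZ d (∂^ iC l P)) w⁺≡k+[w⁺∸k]
          (∂^-preserves-degree {m = w⁺} ≡.refl l P (bihomogeneous-XYZ {w⁺} {w⁻} P bihomogeneous))) ,
      ∂^-preserves-degree {m = w⁻ ∸ l} ≡.refl k (∂^ iC l P)
        (∂^-lowers-degree ≡.refl l P
          (≡.subst (λ d → Homogeneous (not ∘ isXYZ) d P) w⁻≡l+[w⁻∸l]
            (bihomogeneous-ABC {w⁺} {w⁻} P bihomogeneous)))
      where
      w⁺≡k+[w⁺∸k] = ≡.sym (ℕₚ.m+[n∸m]≡n k≤w⁺)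
      w⁻≡l+[w⁻∸l] = ≡.sym (ℕₚ.m+[n∸m]≡n l≤w⁻)

    ∇-point : (Fin 2 → Carrier) → Fin 6 → Carrier
    ∇-point ρ 0F = ρ 0F
    ∇-point ρ 1F = ρ 1F
    ∇-point ρ 2F = 0#
    ∇-point ρ 3F = - ρ 1F
    ∇-point ρ 4F = ρ 0F
    ∇-point ρ 5F = 0#

    ⟦∇⟧ : ∀ κ k l P ρ → ⟦ ∇ κ k l P ⟧ ρ ≈ κ * ⟦ ∂^ iZ k (∂^ iC l P) ⟧ (∇-point ρ)
    ⟦∇⟧ κ k l P ρ = *-congˡ (trans (⟦subst⟧ _ Q ρ)
      (⟦⟧-cong Q λ { 0F → refl ; 1F → refl ; 2F → refl ; 3F → refl ; 4F → refl ; 5F → refl }))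
      where Q = ∂^ iZ k (∂^ iC l P)

    act₂-point : GL₂ → (Fin 2 → Carrier) → Fin 2 → Carrier
    act₂-point g ρ i = ⟦ act₂ g (var i) ⟧ ρ

    ϱ3ι-∇-point : ∀ g ρ j →
      ⟦ ϱ3ι g (var j) ⟧ (∇-point ρ) ≈ scale (not ∘ isXYZ) (GL₂.δ g) (∇-point (act₂-point g ρ)) j
    ϱ3ι-∇-point g ρ 0F = sym (*-identityˡ _)
    ϱ3ι-∇-point g ρ 1F = sym (*-identityˡ _)
    ϱ3ι-∇-point g ρ 2F = sym (*-identityˡ _)
    ϱ3ι-∇-point g ρ 3F = *-congˡ (lemma _ _ _ _)
      where
      lemma : ∀ b d x y → d * - y + - (b * x) ≈ - (b * x + d * y)
      lemma = solve 4 (λ b d x y → d :* (:- y) :+ :- (b :* x) := :- (b :* x :+ d :* y)) refl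
    ϱ3ι-∇-point g ρ 4F = *-congˡ (lemma _ _ _ _)
      where
      lemma : ∀ a c x y → - (c * - y) + a * x ≈ a * x + c * y
      lemma = solve 4 (λ a c x y → :- (c :* (:- y)) :+ a :* x := a :* x :+ c :* y) refl
    ϱ3ι-∇-point g ρ 5F = sym (zeroʳ _)

    ∂-ϱ3ι-unused : ∀ i g j → mentions i (ϱ3ι g (var j)) ≡ false → ∂ i (ϱ3ι g (var j)) ≐ con 1# ⊗ con 0#
    ∂-ϱ3ι-unused i g j unused ρ = trans (∂-unused i (ϱ3ι g (var j)) unused ρ) (sym (zeroʳ 1#))

    ϱ3ι-∂Z-compatible : ∀ g → ∂-Compatible iZ 1# (λ j → ϱ3ι g (var j))
    ϱ3ι-∂Z-compatible g 0F   = ∂-ϱ3ι-unused iZ g 0F ≡.refl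
    ϱ3ι-∂Z-compatible g 1F   = ∂-ϱ3ι-unused iZ g 1F ≡.refl
    ϱ3ι-∂Z-compatible g 2F _ = sym (*-identityˡ 1#)
    ϱ3ι-∂Z-compatible g 3F   = ∂-ϱ3ι-unused iZ g 3F ≡.refl
    ϱ3ι-∂Z-compatible g 4F   = ∂-ϱ3ι-unused iZ g 4F ≡.refl
    ϱ3ι-∂Z-compatible g 5F   = ∂-ϱ3ι-unused iZ g 5F ≡.refl

    ϱ3ι-∂C-compatible : ∀ g → ∂-Compatible iC 1# (λ j → ϱ3ι g (var j))
    ϱ3ι-∂C-compatible g 0F   = ∂-ϱ3ι-unused iC g 0F ≡.refl
    ϱ3ι-∂C-compatible g 1F   = ∂-ϱ3ι-unused iC g 1F ≡.refl
    ϱ3ι-∂C-compatible g 2F   = ∂-ϱ3ι-unused iC g 2F ≡.refl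
    ϱ3ι-∂C-compatible g 3F   = ∂-ϱ3ι-unused iC g 3F ≡.refl
    ϱ3ι-∂C-compatible g 4F   = ∂-ϱ3ι-unused iC g 4F ≡.refl
    ϱ3ι-∂C-compatible g 5F _ = sym (*-identityˡ 1#)

    ϱ3ι-∂ZC-commute : ∀ g k l P → ∂^ iZ k (∂^ iC l (ϱ3ι g P)) ≐ ϱ3ι g (∂^ iZ k (∂^ iC l P))
    ϱ3ι-∂ZC-commute g k l P ρ =
      trans (∂^-cong iZ k {∂^ iC l (ϱ3ι g P)} {ϱ3ι g (∂^ iC l P)}
                     (∂^-subst (ϱ3ι-∂C-compatible g) l P) ρ)
            (∂^-subst (ϱ3ι-∂Z-compatible g) k (∂^ iC l P) ρ)

    ∇-equivariant : ∀ κ k l m P g → Homogeneous (not ∘ isXYZ) m (∂^ iZ k (∂^ iC l P)) →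
                    ∇ κ k l (ϱ3ι g P) ≐ con (pow (GL₂.δ g) m) ⊗ act₂ g (∇ κ k l P)
    ∇-equivariant κ k l m P g homogeneous ρ = begin
      ⟦ ∇ κ k l (ϱ3ι g P) ⟧ ρ                         ≈⟨ ⟦∇⟧ κ k l (ϱ3ι g P) ρ ⟩
      κ * ⟦ ∂^ iZ k (∂^ iC l (ϱ3ι g P)) ⟧ (∇-point ρ) ≈⟨ *-congˡ (ϱ3ι-∂ZC-commute g k l P _) ⟩
      κ * ⟦ ϱ3ι g Q ⟧ (∇-point ρ)                     ≈⟨ *-congˡ (⟦subst⟧ _ Q _) ⟩
      κ * ⟦ Q ⟧ (λ j → ⟦ ϱ3ι g (var j) ⟧ (∇-point ρ)) ≈⟨ *-congˡ (⟦⟧-cong Q (ϱ3ι-∇-point g ρ)) ⟩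
      κ * ⟦ Q ⟧ (scale (not ∘ isXYZ) δ (∇-point ρg))  ≈⟨ *-congˡ (homogeneous δ _) ⟩
      κ * (pow δ m * ⟦ Q ⟧ (∇-point ρg))              ≈⟨ x∙yz≈y∙xz _ _ _ ⟩
      pow δ m * (κ * ⟦ Q ⟧ (∇-point ρg))              ≈⟨ *-congˡ (⟦∇⟧ κ k l P ρg) ⟨
      pow δ m * ⟦ ∇ κ k l P ⟧ ρg                      ≈⟨ *-congˡ (⟦subst⟧ _ (∇ κ k l P) ρ) ⟨
      ⟦ con (pow δ m) ⊗ act₂ g (∇ κ k l P) ⟧ ρ        ∎
      where
      Q  = ∂^ iZ k (∂^ iC l P)
      δ  = GL₂.δ g
      ρg = act₂-point g ρ

    ∇-homogeneous : ∀ κ k l m P → Homogeneous (λ _ → true) m (∂^ iZ k (∂^ iC l P)) →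
                    IsHomogeneous₂ m (∇ κ k l P)
    ∇-homogeneous κ k l m P homogeneous t ρ = begin
      ⟦ ∇ κ k l P ⟧ (λ i → t * ρ i)                ≈⟨ ⟦∇⟧ κ k l P _ ⟩
      κ * ⟦ Q ⟧ (∇-point (λ i → t * ρ i))          ≈⟨ *-congˡ (⟦⟧-cong Q ∇-point-scale) ⟩
      κ * ⟦ Q ⟧ (scale (λ _ → true) t (∇-point ρ)) ≈⟨ *-congˡ (homogeneous t _) ⟩
      κ * (pow t m * ⟦ Q ⟧ (∇-point ρ))            ≈⟨ x∙yz≈y∙xz _ _ _ ⟩
      pow t m * (κ * ⟦ Q ⟧ (∇-point ρ))            ≈⟨ *-congˡ (⟦∇⟧ κ k l P ρ) ⟨
      pow t m * ⟦ ∇ κ k l P ⟧ ρ                    ∎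
      where
      Q = ∂^ iZ k (∂^ iC l P)
      ∇-point-scale : ∀ j → ∇-point (λ i → t * ρ i) j ≈ t * ∇-point ρ j
      ∇-point-scale 0F = refl
      ∇-point-scale 1F = refl
      ∇-point-scale 2F = sym (zeroʳ t)
      ∇-point-scale 3F = -‿distribʳ-* t _
      ∇-point-scale 4F = refl
      ∇-point-scale 5F = sym (zeroʳ t)

-- The identity holds for every scalar κ.
lemma3p1 : ∀ {c ℓ} (R : CommutativeRing c ℓ) →
    let open CommutativeRing R in
    let open Defs.Poly R in
    IsIntegralDomain → HasCharZero →
    (w⁺ w⁻ : ℕ) → Σ[ u ∈ Carrier ] (fromℕ (w⁺ !ℕ *ℕ w⁻ !ℕ) * u ≈ 1#) →
    (k l : ℕ) → k ≤ w⁺ → l ≤ w⁻ →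
    (κ : Carrier) → fromℕ (k !ℕ *ℕ l !ℕ) * κ ≈ 1# →
    (P : Expr 6) → IsBihomogeneous w⁺ w⁻ P → (g : GL₂) →
    (∇ κ k l (ϱ3ι g P) ≐ con (pow (GL₂.δ g) (w⁻ ∸ l)) ⊗ act₂ g (∇ κ k l P))
    × IsHomogeneous₂ ((w⁺ ∸ k) +ℕ (w⁻ ∸ l)) (∇ κ k l P)
lemma3p1 R isDomain charZero w⁺ w⁻ _ k l k≤w⁺ l≤w⁻ κ _ P bihomogeneous g =
  ∇-equivariant R isDomain charZero κ k l (w⁻ ∸ l) P g in-ABC ,
  ∇-homogeneous R isDomain charZero κ k l ((w⁺ ∸ k) +ℕ (w⁻ ∸ l)) P
    (homogeneous-+ R {a = w⁺ ∸ k} {b = w⁻ ∸ l} {e = ∂^ iZ k (∂^ iC l P)} in-XYZ in-ABC)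
  where
  open Poly R using (∂^; iZ; iC)
  in-XYZ = proj₁ (∂ZC-bihomogeneous R isDomain charZero P bihomogeneous k≤w⁺ l≤w⁻)
  in-ABC = proj₂ (∂ZC-bihomogeneous R isDomain charZero P bihomogeneous k≤w⁺ l≤w⁻)
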